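{- For each integer $n\geq 3$, $\mathrm{src}(C_n\square C_2)=\left\lceil\frac{n+1}{2}\right\rceil$.
   Context: All graphs are finite, simple and connected; $C_n$ is the cycle on $n$ vertices and $C_2$ denotes the graph with two vertices joined by a single edge. An edge-coloring $\zeta:E(\Gamma)\to\{1,\ldots,k\}$ (adjacent edges may share colors) is a strong rainbow $k$-coloring if every two distinct vertices $u,v$ are joined by a path of length $d(u,v)$ (the graph distance) whose edges have pairwise distinct colors. The strong rainbow connection number $\mathrm{src}(\Gamma)$ is the minimum $k$ for which a strong rainbow $k$-coloring of $\Gamma$ exists. The Cartesian product $\Gamma\square\Lambda$ has vertex set $V(\Gamma)\times V(\Lambda)$, with $(\gamma,\lambda)$ adjacent to $(\gamma',\lambda')$ iff either $\lambda=\lambda'$ and $\gamma\gamma'\in E(\Gamma)$, or $\gamma=\gamma'$ and $\lambda\lambda'\in E(\Lambda)$. -}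

module Defs where

open import Level using (0ℓ)
open import Data.Nat using (ℕ; zero; suc; _≤_)
open import Data.Fin using (Fin; toℕ)
open import Data.Product using (_×_; _,_; Σ; ∃-syntax)
open import Data.Sum using (_⊎_)
open import Data.List using (List; []; _∷_)
open import Data.List.Relation.Unary.Unique.Propositional using (Unique)
open import Relation.Binary.PropositionalEquality using (_≡_; _≢_)

record Graph : Set₁ where
  field
    V   : Set
    Adj : V → V → Set
open Graph public

-- Cycle C_n on vertices 0..n-1: i ~ j iff they are consecutive
-- (j = i+1 or i = j+1) or {i,j} = {n-1, 0}.
-- (Used for n ≥ 3, where this is the simple n-cycle.)
CycleAdj : (n : ℕ) → Fin n → Fin n → Set
CycleAdj n i j =
  (toℕ j ≡ suc (toℕ i)) ⊎ (toℕ i ≡ suc (toℕ j)) ⊎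
  (suc (toℕ i) ≡ n × toℕ j ≡ 0) ⊎ (suc (toℕ j) ≡ n × toℕ i ≡ 0)

Cycle : (n : ℕ) → Graph
Cycle n = record { V = Fin n ; Adj = CycleAdj n }

C₂ : Graph
C₂ = record { V = Fin 2 ; Adj = λ i j → i ≢ j }

_□_ : Graph → Graph → Graph
Γ □ Λ = record
  { V   = V Γ × V Λ
  ; Adj = λ { (g , l) (g′ , l′) →
              (l ≡ l′ × Adj Γ g g′) ⊎ (g ≡ g′ × Adj Λ l l′) }
  }

data Walk (G : Graph) : V G → V G → Set where
  [] : ∀ {u} → Walk G u u
  _∷_ : ∀ {u w v} → Adj G u w → Walk G w v → Walk G u v

walkLength : ∀ {G u v} → Walk G u v → ℕ
walkLength [] = 0
walkLength (_ ∷ p) = suc (walkLength p)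

-- An edge-colouring with k colours: a colour for each ordered adjacent pair,
-- symmetric, so it is a colouring of the (undirected) edges.
-- Colours are Fin k, i.e. k colours.
record EdgeColoring (G : Graph) (k : ℕ) : Set where
  field
    col : V G → V G → Fin k
    sym : ∀ u v → Adj G u v → col u v ≡ col v u
open EdgeColoring public

walkColors : ∀ {G k u v} → EdgeColoring G k → Walk G u v → List (Fin k)
walkColors c ([] ) = []
walkColors {u = u} c (_∷_ {w = w} _ p) = col c u w ∷ walkColors c p

IsGeodesic : ∀ {G u v} → Walk G u v → Set
IsGeodesic {G} {u} {v} p = ∀ (q : Walk G u v) → walkLength p ≤ walkLength q

IsStrongRainbow : ∀ {G k} → EdgeColoring G k → Set
IsStrongRainbow {G} c =
  ∀ (u v : V G) → u ≢ v →
    Σ (Walk G u v) λ p → IsGeodesic p × Unique (walkColors c p)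

SrcIs : Graph → ℕ → Set
SrcIs G m =
  (Σ (EdgeColoring G m) IsStrongRainbow) ×
  (∀ k → (c : EdgeColoring G k) → IsStrongRainbow c → m ≤ k)

module Submission where

-- For the forward offset g from x to y, the ring
-- norm min(g, n − g) plus the layer difference bounds every walk in the prism
-- from below (it vanishes on the diagonal and is 1-Lipschitz along edges), so
-- walks attaining it are geodesics.
-- Lower bound: (x, 0) and (x + m, 1) are m + 1 apart, so a rainbow geodesic
-- between them shows m + 1 distinct colours, but a duplicate-free list over
-- Fin k has at most k entries.
-- Upper bound: a spread colouring keeps equally coloured cycle edges at least m
-- steps apart and makes the rung at y avoid the colours of the m edges before y;
-- then the shorter arc between x and y, followed by a rung if needed, is a
-- rainbow geodesic.  Colouring edge x by x mod m (adjusted for odd n) is spread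
-- and uses m + 1 colours.

open import Defs hiding (sym)
open import Data.Empty using (⊥-elim)
open import Data.Fin as Fin using (Fin; zero; suc; toℕ; fromℕ<)
open import Data.Fin.Properties using (toℕ<n; toℕ-fromℕ<; toℕ-injective; fromℕ<-injective)
import Data.Fin.Properties as Finₚ
open import Data.List using (List; []; _∷_; _++_; [_]; length; lookup; reverse; applyUpTo)
open import Data.List.Properties using (unfold-reverse)
open import Data.List.Membership.Propositional using (_∈_)
open import Data.List.Membership.Propositional.Properties using (∈-lookup; ∈-applyUpTo⁻)
open import Data.List.Relation.Binary.Disjoint.Propositional using (Disjoint)
import Data.List.Relation.Binary.Permutation.Setoid as Permutation
import Data.List.Relation.Binary.Permutation.Setoid.Properties as Permutationₚ
import Data.List.Relation.Unary.All as All
open import Data.List.Relation.Unary.Any using (here)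
open import Data.List.Relation.Unary.Unique.Propositional using (Unique; []; _∷_)
import Data.List.Relation.Unary.Unique.Propositional.Properties as Uniqueₚ
open import Data.Nat using (ℕ; zero; suc; _+_; _∸_; _*_; _/_; _%_; _⊓_; ⌊_/2⌋; ⌈_/2⌉;
                            _≤_; _<_; _≮_; z≤n; s≤s; z<s; _≤?_; _<?_; NonZero; >-nonZero⁻¹)
open import Data.Nat.DivMod
open import Data.Nat.Properties
open import Data.Product using (Σ; _×_; _,_; proj₁; proj₂)
open import Data.Sum using (_⊎_; inj₁; inj₂)
open import Relation.Binary.PropositionalEquality hiding ([_])
open import Relation.Nullary using (yes; no; ¬_)

%-wrap : ∀ {a b} n .{{_ : NonZero n}} → a < n + n → a % n ≡ b → a ≡ b ⊎ a ≡ b + n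
%-wrap {a} {b} n a<2n a%n≡b with a <? n
... | yes a<n = inj₁ (trans (sym (m<n⇒m%n≡m a<n)) a%n≡b)
... | no  a≮n = inj₂ (begin
  a          ≡⟨ sym (m∸n+n≡m n≤a) ⟩
  a ∸ n + n  ≡⟨ cong (_+ n) a∸n≡b ⟩
  b + n      ∎)
  where
  open ≡-Reasoning
  n≤a : n ≤ a
  n≤a = ≮⇒≥ a≮n
  a∸n<n : a ∸ n < n
  a∸n<n = +-cancelʳ-< n (a ∸ n) n (subst (_< n + n) (sym (m∸n+n≡m n≤a)) a<2n)
  a∸n≡b : a ∸ n ≡ b
  a∸n≡b = trans (sym (m<n⇒m%n≡m a∸n<n)) (trans (m≤n⇒[n∸m]%m≡n%m n≤a) a%n≡b)

residue-gap : ∀ {a b} m .{{_ : NonZero m}} → a % m ≡ b % m → a < b → a + m ≤ b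
residue-gap {a} {b} m same a<b = begin
  a + m                       ≡⟨ cong (_+ m) (m≡m%n+[m/n]*n a m) ⟩
  a % m + a / m * m + m       ≡⟨ +-assoc (a % m) (a / m * m) m ⟩
  a % m + (a / m * m + m)     ≡⟨ cong (a % m +_) (+-comm (a / m * m) m) ⟩
  a % m + suc (a / m) * m     ≤⟨ +-monoʳ-≤ (a % m) (*-monoˡ-≤ m quotient<) ⟩
  a % m + b / m * m           ≡⟨ cong (_+ b / m * m) same ⟩
  b % m + b / m * m           ≡⟨ sym (m≡m%n+[m/n]*n b m) ⟩
  b                           ∎
  where
  open ≤-Reasoning
  quotient< : a / m < b / m
  quotient< = *-cancelʳ-< m (a / m) (b / m) (+-cancelˡ-< (a % m) (a / m * m) (b / m * m)
    (subst₂ _<_ (m≡m%n+[m/n]*n a m) (trans (m≡m%n+[m/n]*n b m) (cong (_+ b / m * m) (sym same))) a<b))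

+-double-residue : ∀ a m .{{_ : NonZero m}} → (a + (m + m)) % m ≡ a % m
+-double-residue a m = trans (cong (_% m) (sym (+-assoc a m m)))
                             (trans ([m+n]%n≡m%n (a + m) m) ([m+n]%n≡m%n a m))

∸-suc-≤ : ∀ n g → n ∸ g ≤ suc (n ∸ suc g)
∸-suc-≤ zero    g       = ≤-trans (≤-reflexive (0∸n≡0 g)) z≤n
∸-suc-≤ (suc n) zero    = ≤-refl
∸-suc-≤ (suc n) (suc g) = ∸-suc-≤ n g

halving : ∀ n → n ≡ ⌊ n /2⌋ + ⌊ n /2⌋ ⊎ n ≡ suc (⌊ n /2⌋ + ⌊ n /2⌋)
halving zero          = inj₁ refl
halving (suc zero)    = inj₂ refl
halving (suc (suc n)) with halving n
... | inj₁ even = inj₁ (cong suc (trans (cong suc even) (sym (+-suc ⌊ n /2⌋ ⌊ n /2⌋))))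
... | inj₂ odd  = inj₂ (cong suc (trans (cong suc odd) (cong suc (sym (+-suc ⌊ n /2⌋ ⌊ n /2⌋)))))

unique-lookup-injective : ∀ {A : Set} {xs : List A} → Unique xs →
                          ∀ {i j} → lookup xs i ≡ lookup xs j → i ≡ j
unique-lookup-injective (_   ∷ _) {zero}  {zero}  _ = refl
unique-lookup-injective (x∉ ∷ _) {zero}  {suc j} e = ⊥-elim (All.lookup x∉ (∈-lookup j) e)
unique-lookup-injective (x∉ ∷ _) {suc i} {zero}  e = ⊥-elim (All.lookup x∉ (∈-lookup i) (sym e))
unique-lookup-injective (_   ∷ u) {suc i} {suc j} e = cong suc (unique-lookup-injective u e)

unique-length≤ : ∀ {k} {xs : List (Fin k)} → Unique xs → length xs ≤ k
unique-length≤ {k} {xs} u with k <? length xs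
... | no  k≮len = ≮⇒≥ k≮len
... | yes k<len with i , j , i<j , same ← Finₚ.pigeonhole k<len (lookup xs) =
  ⊥-elim (Finₚ.<⇒≢ i<j (unique-lookup-injective u same))

unique-reverse : ∀ {A : Set} {xs : List A} → Unique xs → Unique (reverse xs)
unique-reverse {A} {xs} = Permutationₚ.Unique-resp-↭ S (Permutation.↭-sym S (Permutationₚ.↭-reverse S xs))
  where S = setoid A

module Walks (G : Graph) where

  infixr 5 _++ʷ_
  _++ʷ_ : ∀ {u w v} → Walk G u w → Walk G w v → Walk G u v
  []      ++ʷ q = q
  (e ∷ p) ++ʷ q = e ∷ (p ++ʷ q)

  length-++ʷ : ∀ {u w v} (p : Walk G u w) (q : Walk G w v) →
               walkLength (p ++ʷ q) ≡ walkLength p + walkLength q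
  length-++ʷ []      q = refl
  length-++ʷ (e ∷ p) q = cong suc (length-++ʷ p q)

  colours-++ʷ : ∀ {k u w v} (c : EdgeColoring G k) (p : Walk G u w) (q : Walk G w v) →
                walkColors c (p ++ʷ q) ≡ walkColors c p ++ walkColors c q
  colours-++ʷ c []      q = refl
  colours-++ʷ c (e ∷ p) q = cong (_ ∷_) (colours-++ʷ c p q)

  length-colours : ∀ {k u v} (c : EdgeColoring G k) (p : Walk G u v) →
                   length (walkColors c p) ≡ walkLength p
  length-colours c []      = refl
  length-colours c (e ∷ p) = cong suc (length-colours c p)

  module Reversal (adj-sym : ∀ {u v} → Adj G u v → Adj G v u) where
    open ≡-Reasoning

    reverseʷ : ∀ {u v} → Walk G u v → Walk G v u
    reverseʷ []      = []
    reverseʷ (e ∷ p) = reverseʷ p ++ʷ (adj-sym e ∷ [])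

    length-reverseʷ : ∀ {u v} (p : Walk G u v) → walkLength (reverseʷ p) ≡ walkLength p
    length-reverseʷ []      = refl
    length-reverseʷ (e ∷ p) = begin
      walkLength (reverseʷ p ++ʷ (adj-sym e ∷ []))  ≡⟨ length-++ʷ (reverseʷ p) _ ⟩
      walkLength (reverseʷ p) + 1                   ≡⟨ cong (_+ 1) (length-reverseʷ p) ⟩
      walkLength p + 1                              ≡⟨ +-comm (walkLength p) 1 ⟩
      suc (walkLength p)                            ∎

    colours-reverseʷ : ∀ {k u v} (c : EdgeColoring G k) (p : Walk G u v) →
                       walkColors c (reverseʷ p) ≡ reverse (walkColors c p)
    colours-reverseʷ c []                          = refl
    colours-reverseʷ c (_∷_ {u = u} {w = w} e p) = begin
      walkColors c (reverseʷ p ++ʷ (adj-sym e ∷ []))    ≡⟨ colours-++ʷ c (reverseʷ p) _ ⟩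
      walkColors c (reverseʷ p) ++ [ col c w u ]         ≡⟨ cong₂ (λ xs y → xs ++ [ y ]) (colours-reverseʷ c p)
                                                                   (sym (EdgeColoring.sym c u w e)) ⟩
      reverse (walkColors c p) ++ [ col c u w ]          ≡⟨ sym (unfold-reverse (col c u w) (walkColors c p)) ⟩
      reverse (col c u w ∷ walkColors c p)               ∎

    geodesic-reverseʷ : ∀ {u v} (p : Walk G u v) → IsGeodesic p → IsGeodesic (reverseʷ p)
    geodesic-reverseʷ p geo q =
      subst₂ _≤_ (sym (length-reverseʷ p)) (length-reverseʷ q) (geo (reverseʷ q))

cycleAdj-sym : ∀ {n x y} → CycleAdj n x y → CycleAdj n y x
cycleAdj-sym (inj₁ e)                 = inj₂ (inj₁ e)
cycleAdj-sym (inj₂ (inj₁ e))          = inj₁ e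
cycleAdj-sym (inj₂ (inj₂ (inj₁ e)))   = inj₂ (inj₂ (inj₂ e))
cycleAdj-sym (inj₂ (inj₂ (inj₂ e)))   = inj₂ (inj₂ (inj₁ e))

module CycleArithmetic (n : ℕ) .{{_ : NonZero n}} where
  open ≡-Reasoning

  %-absorbˡ : ∀ a b → (a % n + b) % n ≡ (a + b) % n
  %-absorbˡ a b = begin
    (a % n + b) % n          ≡⟨ %-distribˡ-+ (a % n) b n ⟩
    (a % n % n + b % n) % n  ≡⟨ cong (λ z → (z + b % n) % n) (m%n%n≡m%n a n) ⟩
    (a % n + b % n) % n      ≡⟨ sym (%-distribˡ-+ a b n) ⟩
    (a + b) % n              ∎

  %-absorbʳ : ∀ a b → (a + b % n) % n ≡ (a + b) % n
  %-absorbʳ a b = begin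
    (a + b % n) % n  ≡⟨ cong (_% n) (+-comm a (b % n)) ⟩
    (b % n + a) % n  ≡⟨ %-absorbˡ b a ⟩
    (b + a) % n      ≡⟨ cong (_% n) (+-comm b a) ⟩
    (a + b) % n      ∎

  x+[n∸x]≡n : ∀ (x : Fin n) → toℕ x + (n ∸ toℕ x) ≡ n
  x+[n∸x]≡n x = m+[n∸m]≡n (<⇒≤ (toℕ<n x))

  next : Fin n → Fin n
  next x = fromℕ< (m%n<n (suc (toℕ x)) n)

  toℕ-next : ∀ x → toℕ (next x) ≡ suc (toℕ x) % n
  toℕ-next x = toℕ-fromℕ< (m%n<n (suc (toℕ x)) n)

  shift : ℕ → Fin n → Fin n
  shift zero    x = x
  shift (suc k) x = shift k (next x)

  toℕ-shift : ∀ k x → toℕ (shift k x) ≡ (toℕ x + k) % n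
  toℕ-shift zero    x = sym (trans (cong (_% n) (+-identityʳ (toℕ x))) (m<n⇒m%n≡m (toℕ<n x)))
  toℕ-shift (suc k) x = begin
    toℕ (shift k (next x))     ≡⟨ toℕ-shift k (next x) ⟩
    (toℕ (next x) + k) % n     ≡⟨ cong (λ z → (z + k) % n) (toℕ-next x) ⟩
    (suc (toℕ x) % n + k) % n  ≡⟨ %-absorbˡ (suc (toℕ x)) k ⟩
    (suc (toℕ x) + k) % n      ≡⟨ cong (_% n) (sym (+-suc (toℕ x) k)) ⟩
    (toℕ x + suc k) % n        ∎

  shift-+ : ∀ j k x → shift (j + k) x ≡ shift k (shift j x)
  shift-+ zero    k x = refl
  shift-+ (suc j) k x = shift-+ j k (next x)

  shift-n : ∀ x → shift n x ≡ x
  shift-n x = toℕ-injective (begin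
    toℕ (shift n x)   ≡⟨ toℕ-shift n x ⟩
    (toℕ x + n) % n   ≡⟨ [m+n]%n≡m%n (toℕ x) n ⟩
    toℕ x % n         ≡⟨ m<n⇒m%n≡m (toℕ<n x) ⟩
    toℕ x             ∎)

  offset : Fin n → Fin n → ℕ
  offset x y = (toℕ y + (n ∸ toℕ x)) % n

  offset<n : ∀ x y → offset x y < n
  offset<n x y = m%n<n (toℕ y + (n ∸ toℕ x)) n

  offset-shift : ∀ k x → offset x (shift k x) ≡ k % n
  offset-shift k x = begin
    (toℕ (shift k x) + (n ∸ toℕ x)) % n    ≡⟨ cong (λ z → (z + (n ∸ toℕ x)) % n) (toℕ-shift k x) ⟩
    ((toℕ x + k) % n + (n ∸ toℕ x)) % n    ≡⟨ %-absorbˡ (toℕ x + k) (n ∸ toℕ x) ⟩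
    (toℕ x + k + (n ∸ toℕ x)) % n          ≡⟨ cong (λ z → (z + (n ∸ toℕ x)) % n) (+-comm (toℕ x) k) ⟩
    (k + toℕ x + (n ∸ toℕ x)) % n          ≡⟨ cong (_% n) (+-assoc k (toℕ x) (n ∸ toℕ x)) ⟩
    (k + (toℕ x + (n ∸ toℕ x))) % n        ≡⟨ cong (λ z → (k + z) % n) (x+[n∸x]≡n x) ⟩
    (k + n) % n                            ≡⟨ [m+n]%n≡m%n k n ⟩
    k % n                                  ∎

  offset-shift-< : ∀ {k} x → k < n → offset x (shift k x) ≡ k
  offset-shift-< {k} x k<n = trans (offset-shift k x) (m<n⇒m%n≡m k<n)

  shift-offset : ∀ x y → shift (offset x y) x ≡ y
  shift-offset x y = toℕ-injective (begin
    toℕ (shift (offset x y) x)                ≡⟨ toℕ-shift (offset x y) x ⟩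
    (toℕ x + (toℕ y + (n ∸ toℕ x)) % n) % n   ≡⟨ %-absorbʳ (toℕ x) (toℕ y + (n ∸ toℕ x)) ⟩
    (toℕ x + (toℕ y + (n ∸ toℕ x))) % n       ≡⟨ cong (_% n) (+-comm (toℕ x) (toℕ y + (n ∸ toℕ x))) ⟩
    (toℕ y + (n ∸ toℕ x) + toℕ x) % n         ≡⟨ cong (_% n) (+-assoc (toℕ y) (n ∸ toℕ x) (toℕ x)) ⟩
    (toℕ y + ((n ∸ toℕ x) + toℕ x)) % n       ≡⟨ cong (λ z → (toℕ y + z) % n) (m∸n+n≡m (<⇒≤ (toℕ<n x))) ⟩
    (toℕ y + n) % n                           ≡⟨ [m+n]%n≡m%n (toℕ y) n ⟩
    toℕ y % n                                 ≡⟨ m<n⇒m%n≡m (toℕ<n y) ⟩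
    toℕ y                                     ∎)

  offset-self : ∀ x → offset x x ≡ 0
  offset-self x = offset-shift-< x (>-nonZero⁻¹ n)

  offset≡0⇒≡ : ∀ {x y} → offset x y ≡ 0 → x ≡ y
  offset≡0⇒≡ {x} {y} g≡0 = trans (cong (λ k → shift k x) (sym g≡0)) (shift-offset x y)

  offset-shift-shift : ∀ {i j} x → i ≤ j → j < n → offset (shift i x) (shift j x) ≡ j ∸ i
  offset-shift-shift {i} {j} x i≤j j<n = begin
    offset (shift i x) (shift j x)                   ≡⟨ cong (λ k → offset (shift i x) (shift k x)) (sym (m+[n∸m]≡n i≤j)) ⟩
    offset (shift i x) (shift (i + (j ∸ i)) x)       ≡⟨ cong (offset (shift i x)) (shift-+ i (j ∸ i) x) ⟩
    offset (shift i x) (shift (j ∸ i) (shift i x))   ≡⟨ offset-shift-< (shift i x) (≤-<-trans (m∸n≤m j i) j<n) ⟩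
    j ∸ i                                            ∎

  offset-spec : ∀ x y → toℕ x + offset x y ≡ toℕ y ⊎ toℕ x + offset x y ≡ toℕ y + n
  offset-spec x y = %-wrap n (+-mono-< (toℕ<n x) (offset<n x y))
    (trans (sym (toℕ-shift (offset x y) x)) (cong toℕ (shift-offset x y)))

  offset-sum : ∀ {x y} → x ≢ y → offset x y + offset y x ≡ n
  offset-sum {x} {y} x≢y with %-wrap n (+-mono-< (offset<n x y) (offset<n y x)) round-trip
    where
    round-trip : (offset x y + offset y x) % n ≡ 0
    round-trip = begin
      (offset x y + offset y x) % n                          ≡⟨ sym (offset-shift _ x) ⟩
      offset x (shift (offset x y + offset y x) x)           ≡⟨ cong (offset x) (shift-+ (offset x y) (offset y x) x) ⟩
      offset x (shift (offset y x) (shift (offset x y) x))   ≡⟨ cong (λ z → offset x (shift (offset y x) z)) (shift-offset x y) ⟩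
      offset x (shift (offset y x) y)                        ≡⟨ cong (offset x) (shift-offset y x) ⟩
      offset x x                                             ≡⟨ offset-self x ⟩
      0                                                      ∎
  ... | inj₂ sum≡n = sum≡n
  ... | inj₁ sum≡0 = ⊥-elim (x≢y (offset≡0⇒≡ (m+n≡0⇒m≡0 (offset x y) sum≡0)))

  next-follows : ∀ {x y} → suc (toℕ x) ≡ toℕ y → next x ≡ y
  next-follows {x} {y} e = toℕ-injective (begin
    toℕ (next x)       ≡⟨ toℕ-next x ⟩
    suc (toℕ x) % n    ≡⟨ m<n⇒m%n≡m (subst (_< n) (sym e) (toℕ<n y)) ⟩
    suc (toℕ x)        ≡⟨ e ⟩
    toℕ y              ∎)

  next-wraps : ∀ {x y} → suc (toℕ x) ≡ n → toℕ y ≡ 0 → next x ≡ y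
  next-wraps {x} {y} last first = toℕ-injective (begin
    toℕ (next x)      ≡⟨ toℕ-next x ⟩
    suc (toℕ x) % n   ≡⟨ cong (_% n) last ⟩
    n % n             ≡⟨ n%n≡0 n ⟩
    0                 ≡⟨ sym first ⟩
    toℕ y             ∎)

  next-adjacent : ∀ x → CycleAdj n x (next x)
  next-adjacent x with suc (toℕ x) <? n
  ... | yes x+1<n = inj₁ (trans (toℕ-next x) (m<n⇒m%n≡m x+1<n))
  ... | no  x+1≮n = inj₂ (inj₂ (inj₁ (last , trans (toℕ-next x) (trans (cong (_% n) last) (n%n≡0 n)))))
    where last = ≤-antisym (toℕ<n x) (≮⇒≥ x+1≮n)

  adjacent⇒next : ∀ {x y} → CycleAdj n x y → next x ≡ y ⊎ next y ≡ x
  adjacent⇒next (inj₁ e)                         = inj₁ (next-follows (sym e))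
  adjacent⇒next (inj₂ (inj₁ e))                  = inj₂ (next-follows (sym e))
  adjacent⇒next (inj₂ (inj₂ (inj₁ (last , first)))) = inj₁ (next-wraps last first)
  adjacent⇒next (inj₂ (inj₂ (inj₂ (last , first)))) = inj₂ (next-wraps last first)

  next-next≢ : 2 < n → ∀ x → next (next x) ≢ x
  next-next≢ 2<n x back = 2≢0 (begin
    2                             ≡⟨ sym (offset-shift-< x 2<n) ⟩
    offset x (shift 2 x)          ≡⟨ cong (offset x) back ⟩
    offset x x                    ≡⟨ offset-self x ⟩
    0                             ∎)
    where
    2≢0 : 2 ≢ 0
    2≢0 ()

  offset-next : ∀ x y → offset x y ≡ suc (offset (next x) y)
                      ⊎ (offset x y ≡ 0 × suc (offset (next x) y) ≡ n)
  offset-next x y with suc (offset (next x) y) <? n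
  ... | yes g+1<n = inj₁ (begin
    offset x y                                  ≡⟨ cong (offset x) (sym (shift-offset (next x) y)) ⟩
    offset x (shift (suc (offset (next x) y)) x) ≡⟨ offset-shift-< x g+1<n ⟩
    suc (offset (next x) y)                      ∎)
  ... | no  g+1≮n = inj₂ (trans (cong (offset x) y≡x) (offset-self x) , wraps)
    where
    wraps : suc (offset (next x) y) ≡ n
    wraps = ≤-antisym (offset<n (next x) y) (≮⇒≥ g+1≮n)
    y≡x : y ≡ x
    y≡x = begin
      y                                   ≡⟨ sym (shift-offset (next x) y) ⟩
      shift (suc (offset (next x) y)) x   ≡⟨ cong (λ k → shift k x) wraps ⟩
      shift n x                           ≡⟨ shift-n x ⟩
      x                                   ∎

  ringNorm : ℕ → ℕ
  ringNorm g = g ⊓ (n ∸ g)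

  Short : ℕ → Set
  Short g = g + g ≤ n

  short⇒<n : ∀ {g} → Short g → g < n
  short⇒<n {zero}  _      = >-nonZero⁻¹ n
  short⇒<n {suc g} g+g≤n = <-≤-trans (m<m+n (suc g) z<s) g+g≤n

  other-arc-short : ∀ {x y} → x ≢ y → ¬ Short (offset x y) → Short (offset y x)
  other-arc-short {x} {y} x≢y long =
    ≤-trans (+-monoʳ-≤ (offset y x) (<⇒≤ shorter))
            (≤-reflexive (trans (+-comm (offset y x) (offset x y)) (offset-sum x≢y)))
    where
    shorter : offset y x < offset x y
    shorter = ≰⇒> λ g≤g' → long (≤-trans (+-monoʳ-≤ (offset x y) g≤g') (≤-reflexive (offset-sum x≢y)))

  ringNorm-short : ∀ {g} → Short g → ringNorm g ≡ g
  ringNorm-short {g} g+g≤n = m≤n⇒m⊓n≡m (≤-trans (≤-reflexive (sym (m+n∸m≡n g g))) (∸-monoˡ-≤ g g+g≤n))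

  ringNorm-suc : ∀ {g} → suc g ≤ n → ringNorm (suc g) ≤ suc (ringNorm g) × ringNorm g ≤ suc (ringNorm (suc g))
  ringNorm-suc {g} g<n =
    ⊓-mono-≤ ≤-refl (≤-trans (∸-monoʳ-≤ n (n≤1+n g)) (n≤1+n (n ∸ g))) ,
    ⊓-mono-≤ (≤-trans (n≤1+n g) (n≤1+n (suc g))) (∸-suc-≤ n g)

  ringNorm-next : ∀ x y → ringNorm (offset x y) ≤ suc (ringNorm (offset (next x) y))
                        × ringNorm (offset (next x) y) ≤ suc (ringNorm (offset x y))
  ringNorm-next x y with offset-next x y
  ... | inj₁ e rewrite e = ringNorm-suc (offset<n (next x) y)
  ... | inj₂ (e , wraps) rewrite e = z≤n , ≤-trans (m⊓n≤n g (n ∸ g)) (≤-reflexive n∸g≡1)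
    where
    g = offset (next x) y
    n∸g≡1 : n ∸ g ≡ 1
    n∸g≡1 = trans (cong (_∸ g) (sym wraps)) (m+n∸n≡m 1 g)

  ringNorm-adjacent : ∀ {x x'} y → CycleAdj n x x' →
                      ringNorm (offset x y) ≤ suc (ringNorm (offset x' y))
  ringNorm-adjacent {x} {x'} y adj with adjacent⇒next adj
  ... | inj₁ refl = proj₁ (ringNorm-next x y)
  ... | inj₂ refl = proj₂ (ringNorm-next x' y)

module Prism (n : ℕ) .{{_ : NonZero n}} where
  open CycleArithmetic n

  G : Graph
  G = Cycle n □ C₂

  adj-sym : ∀ {u v} → Adj G u v → Adj G v u
  adj-sym (inj₁ (e , adj))  = inj₁ (sym e , cycleAdj-sym adj)
  adj-sym (inj₂ (e , a≢b)) = inj₂ (sym e , λ b≡a → a≢b (sym b≡a))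

  layerDist : Fin 2 → Fin 2 → ℕ
  layerDist zero       zero       = 0
  layerDist zero       (suc zero) = 1
  layerDist (suc zero) zero       = 1
  layerDist (suc zero) (suc zero) = 0

  layerDist-self : ∀ a → layerDist a a ≡ 0
  layerDist-self zero       = refl
  layerDist-self (suc zero) = refl

  layerDist≤1 : ∀ a b → layerDist a b ≤ 1
  layerDist≤1 zero       zero       = z≤n
  layerDist≤1 zero       (suc zero) = ≤-refl
  layerDist≤1 (suc zero) zero       = ≤-refl
  layerDist≤1 (suc zero) (suc zero) = z≤n

  distanceBound : V G → V G → ℕ
  distanceBound (x , a) (y , b) = ringNorm (offset x y) + layerDist a b

  distanceBound-self : ∀ u → distanceBound u u ≡ 0
  distanceBound-self (x , a) = cong₂ _+_ (cong ringNorm (offset-self x)) (layerDist-self a)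

  distanceBound-edge : ∀ {u w} v → Adj G u w → distanceBound u v ≤ suc (distanceBound w v)
  distanceBound-edge {x , a} (y , b) (inj₁ (refl , adj)) =
    +-monoˡ-≤ (layerDist a b) (ringNorm-adjacent y adj)
  distanceBound-edge {x , a} {_ , a'} (y , b) (inj₂ (refl , _)) = begin
    ringNorm (offset x y) + layerDist a b   ≤⟨ +-monoʳ-≤ (ringNorm (offset x y)) (layerDist≤1 a b) ⟩
    ringNorm (offset x y) + 1               ≡⟨ +-comm (ringNorm (offset x y)) 1 ⟩
    suc (ringNorm (offset x y))             ≤⟨ s≤s (m≤m+n (ringNorm (offset x y)) (layerDist a' b)) ⟩
    suc (ringNorm (offset x y) + layerDist a' b) ∎
    where open ≤-Reasoning

  walk-length≥ : ∀ {u v} (p : Walk G u v) → distanceBound u v ≤ walkLength p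
  walk-length≥ {u}     []      = ≤-reflexive (distanceBound-self u)
  walk-length≥ {v = v} (e ∷ p) = ≤-trans (distanceBound-edge v e) (s≤s (walk-length≥ p))

  tight⇒geodesic : ∀ {u v} (p : Walk G u v) → walkLength p ≤ distanceBound u v → IsGeodesic p
  tight⇒geodesic p tight q = ≤-trans tight (walk-length≥ q)

  half-short : Short ⌊ n /2⌋
  half-short = ≤-trans (+-monoʳ-≤ ⌊ n /2⌋ (⌊n/2⌋≤⌈n/2⌉ n)) (≤-reflexive (⌊n/2⌋+⌈n/2⌉≡n n))

  antipodal-bound : ∀ x → distanceBound (x , zero) (shift ⌊ n /2⌋ x , suc zero) ≡ suc ⌊ n /2⌋
  antipodal-bound x = begin
    ringNorm (offset x (shift ⌊ n /2⌋ x)) + 1  ≡⟨ cong (λ g → ringNorm g + 1) (offset-shift-< x (short⇒<n half-short)) ⟩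
    ringNorm ⌊ n /2⌋ + 1                      ≡⟨ cong (_+ 1) (ringNorm-short half-short) ⟩
    ⌊ n /2⌋ + 1                               ≡⟨ +-comm ⌊ n /2⌋ 1 ⟩
    suc ⌊ n /2⌋                               ∎
    where open ≡-Reasoning

  src-lower : Fin n → ∀ k (c : EdgeColoring G k) → IsStrongRainbow c → suc ⌊ n /2⌋ ≤ k
  src-lower x k c rainbow with rainbow (x , zero) (shift ⌊ n /2⌋ x , suc zero) (λ ())
  ... | p , _ , distinct = begin
    suc ⌊ n /2⌋                             ≡⟨ sym (antipodal-bound x) ⟩
    distanceBound (x , zero) (shift ⌊ n /2⌋ x , suc zero) ≤⟨ walk-length≥ p ⟩
    walkLength p                            ≡⟨ sym (length-colours c p) ⟩
    length (walkColors c p)                 ≤⟨ unique-length≤ distinct ⟩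
    k                                       ∎
    where
    open ≤-Reasoning
    open Walks G

-- A spread colouring of C_n with colours below K, relative to the half-length m:
-- the cycle edge from x to next x gets colour edge x, the rung at x gets colour
-- rung x, and equal colours are far apart along the cycle.
record SpreadColouring (n : ℕ) .{{_ : NonZero n}} (m K : ℕ) : Set where
  field
    edge rung   : Fin n → ℕ
    edge<K      : ∀ x → edge x < K
    rung<K      : ∀ x → rung x < K
    edge-spread : ∀ x y → edge x ≡ edge y → x ≡ y ⊎ m ≤ CycleArithmetic.offset n x y
    rung-spread : ∀ x y → edge x ≡ rung y → x ≡ y ⊎ m < CycleArithmetic.offset n x y

-- Along an arc of at most m edges
-- all edge colours differ, and the final rung's colour differs from all of them.
module FromSpread {n m K : ℕ} .{{_ : NonZero n}} (2<n : 2 < n) (n≤2m+1 : n ≤ suc (m + m))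
                  (S : SpreadColouring n m K) where
  open CycleArithmetic n
  open Prism n
  open Walks G
  open Reversal adj-sym
  open SpreadColouring S

  edgeColour rungColour : Fin n → Fin K
  edgeColour x = fromℕ< (edge<K x)
  rungColour x = fromℕ< (rung<K x)

  cycleColour : Fin n → Fin n → Fin K
  cycleColour x y with next x Fin.≟ y
  ... | yes _ = edgeColour x
  ... | no  _ = edgeColour y

  cycleColour-forward : ∀ x → cycleColour x (next x) ≡ edgeColour x
  cycleColour-forward x with next x Fin.≟ next x
  ... | yes _   = refl
  ... | no  x≢x = ⊥-elim (x≢x refl)

  cycleColour-backward : ∀ x → cycleColour (next x) x ≡ edgeColour x
  cycleColour-backward x with next (next x) Fin.≟ x
  ... | yes back = ⊥-elim (next-next≢ 2<n x back)
  ... | no  _    = refl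

  cycleColour-sym : ∀ {x y} → CycleAdj n x y → cycleColour x y ≡ cycleColour y x
  cycleColour-sym {x} {y} adj with adjacent⇒next adj
  ... | inj₁ refl = trans (cycleColour-forward x) (sym (cycleColour-backward x))
  ... | inj₂ refl = trans (cycleColour-backward y) (sym (cycleColour-forward y))

  prismColour : V G → V G → Fin K
  prismColour (x , a) (y , b) with a Fin.≟ b
  ... | yes _ = cycleColour x y
  ... | no  _ = rungColour x

  prismColour-layer : ∀ {x y} a → prismColour (x , a) (y , a) ≡ cycleColour x y
  prismColour-layer a with a Fin.≟ a
  ... | yes _   = refl
  ... | no  a≢a = ⊥-elim (a≢a refl)

  prismColour-rung : ∀ {x y a b} → a ≢ b → prismColour (x , a) (y , b) ≡ rungColour x
  prismColour-rung {a = a} {b} a≢b with a Fin.≟ b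
  ... | yes a≡b = ⊥-elim (a≢b a≡b)
  ... | no  _   = refl

  prismColour-sym : ∀ u v → Adj G u v → prismColour u v ≡ prismColour v u
  prismColour-sym (x , a) (y , .a) (inj₁ (refl , adj)) =
    trans (prismColour-layer a) (trans (cycleColour-sym adj) (sym (prismColour-layer a)))
  prismColour-sym (x , a) (.x , b) (inj₂ (refl , a≢b)) =
    trans (prismColour-rung a≢b) (sym (prismColour-rung (λ b≡a → a≢b (sym b≡a))))

  colouring : EdgeColoring G K
  colouring = record { col = prismColour ; sym = prismColour-sym }

  colours : ∀ {u v} → Walk G u v → List (Fin K)
  colours = walkColors colouring

  RainbowGeodesic : V G → V G → Set
  RainbowGeodesic u v = Σ (Walk G u v) λ p → IsGeodesic p × Unique (colours p)

  arc : ∀ x a d → Walk G (x , a) (shift d x , a)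
  arc x a zero    = []
  arc x a (suc d) = inj₁ (refl , next-adjacent x) ∷ arc (next x) a d

  length-arc : ∀ x a d → walkLength (arc x a d) ≡ d
  length-arc x a zero    = refl
  length-arc x a (suc d) = cong suc (length-arc (next x) a d)

  colours-arc : ∀ x a d → colours (arc x a d) ≡ applyUpTo (λ k → edgeColour (shift k x)) d
  colours-arc x a zero    = refl
  colours-arc x a (suc d) =
    cong₂ _∷_ (trans (prismColour-layer a) (cycleColour-forward x)) (colours-arc (next x) a d)

  cross : ∀ x a b → Walk G (x , a) (x , b)
  cross x zero       zero       = []
  cross x zero       (suc zero) = inj₂ (refl , λ ()) ∷ []
  cross x (suc zero) zero       = inj₂ (refl , λ ()) ∷ []
  cross x (suc zero) (suc zero) = []

  length-cross : ∀ x a b → walkLength (cross x a b) ≡ layerDist a b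
  length-cross x zero       zero       = refl
  length-cross x zero       (suc zero) = refl
  length-cross x (suc zero) zero       = refl
  length-cross x (suc zero) (suc zero) = refl

  colours-cross : ∀ x a b {c} → c ∈ colours (cross x a b) → c ≡ rungColour x
  colours-cross x zero       zero       ()
  colours-cross x zero       (suc zero) (here c≡r) = c≡r
  colours-cross x (suc zero) zero       (here c≡r) = c≡r
  colours-cross x (suc zero) (suc zero) ()

  unique-cross : ∀ x a b → Unique (colours (cross x a b))
  unique-cross x zero       zero       = []
  unique-cross x zero       (suc zero) = All.[] ∷ []
  unique-cross x (suc zero) zero       = All.[] ∷ []
  unique-cross x (suc zero) (suc zero) = []

  short⇒≤m : ∀ {d} → Short d → d ≤ m
  short⇒≤m {d} d+d≤n = ≮⇒≥ λ m<d → n≮n (suc (m + m)) (begin-strict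
    suc (m + m)         <⟨ n<1+n (suc (m + m)) ⟩
    suc (suc (m + m))   ≡⟨ cong suc (sym (+-suc m m)) ⟩
    suc m + suc m       ≤⟨ +-mono-≤ m<d m<d ⟩
    d + d               ≤⟨ d+d≤n ⟩
    n                   ≤⟨ n≤2m+1 ⟩
    suc (m + m)         ∎)
    where open ≤-Reasoning

  arc-offset : ∀ x {i j d} → i ≤ j → j ≤ d → Short d → offset (shift i x) (shift j x) ≡ j ∸ i
  arc-offset x i≤j j≤d short = offset-shift-shift x i≤j (≤-<-trans j≤d (short⇒<n short))

  arc-injective : ∀ x {i j d} → i < j → j ≤ d → Short d → shift i x ≢ shift j x
  arc-injective x {i} {j} i<j j≤d short same = <⇒≢ (m<n⇒0<n∸m i<j) (sym (begin
    j ∸ i                            ≡⟨ sym (arc-offset x (<⇒≤ i<j) j≤d short) ⟩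
    offset (shift i x) (shift j x)   ≡⟨ cong (offset (shift i x)) (sym same) ⟩
    offset (shift i x) (shift i x)   ≡⟨ offset-self (shift i x) ⟩
    0                                ∎))
    where open ≡-Reasoning

  arc-edges-distinct : ∀ x {i j d} → i < j → j < d → Short d →
                       edgeColour (shift i x) ≢ edgeColour (shift j x)
  arc-edges-distinct x {i} {j} {d} i<j j<d short same
    with edge-spread (shift i x) (shift j x) (fromℕ<-injective _ _ _ _ same)
  ... | inj₁ eq  = arc-injective x i<j (<⇒≤ j<d) short eq
  ... | inj₂ far = <⇒≱ (≤-<-trans (m∸n≤m j i) (<-≤-trans j<d (short⇒≤m short)))
                       (subst (m ≤_) (arc-offset x (<⇒≤ i<j) (<⇒≤ j<d) short) far)

  rung-avoids-arc : ∀ x {k d} → k < d → Short d → edgeColour (shift k x) ≢ rungColour (shift d x)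
  rung-avoids-arc x {k} {d} k<d short same
    with rung-spread (shift k x) (shift d x) (fromℕ<-injective _ _ _ _ same)
  ... | inj₁ eq  = arc-injective x k<d ≤-refl short eq
  ... | inj₂ far = <⇒≱ (subst (m <_) (arc-offset x (<⇒≤ k<d) ≤-refl short) far)
                       (≤-trans (m∸n≤m d k) (short⇒≤m short))

  unique-arc : ∀ x a d → Short d → Unique (colours (arc x a d))
  unique-arc x a d short = subst Unique (sym (colours-arc x a d))
    (Uniqueₚ.applyUpTo⁺₁ _ d (λ i<j j<d → arc-edges-distinct x i<j j<d short))

  rainbow-short : ∀ x a b d → Short d → RainbowGeodesic (x , a) (shift d x , b)
  rainbow-short x a b d short = path , tight⇒geodesic path (≤-reflexive tight) , distinct
    where
    open ≡-Reasoning
    path : Walk G (x , a) (shift d x , b)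
    path = arc x a d ++ʷ cross (shift d x) a b

    tight : walkLength path ≡ distanceBound (x , a) (shift d x , b)
    tight = begin
      walkLength path                                          ≡⟨ length-++ʷ (arc x a d) _ ⟩
      walkLength (arc x a d) + walkLength (cross (shift d x) a b) ≡⟨ cong₂ _+_ (length-arc x a d) (length-cross _ a b) ⟩
      d + layerDist a b                                        ≡⟨ cong (_+ layerDist a b) (sym (ringNorm-short short)) ⟩
      ringNorm d + layerDist a b                               ≡⟨ cong (λ g → ringNorm g + layerDist a b)
                                                                        (sym (offset-shift-< x (short⇒<n short))) ⟩
      ringNorm (offset x (shift d x)) + layerDist a b          ∎

    disjoint : Disjoint (colours (arc x a d)) (colours (cross (shift d x) a b))
    disjoint {c} (c∈arc , c∈cross) with ∈-applyUpTo⁻ _ (subst (c ∈_) (colours-arc x a d) c∈arc)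
    ... | k , k<d , refl = rung-avoids-arc x k<d short (colours-cross _ a b c∈cross)

    distinct : Unique (colours path)
    distinct = subst Unique (sym (colours-++ʷ colouring (arc x a d) _))
      (Uniqueₚ.++⁺ (unique-arc x a d short) (unique-cross _ a b) disjoint)

  reverse-rainbow : ∀ {u v} → RainbowGeodesic u v → RainbowGeodesic v u
  reverse-rainbow (p , geodesic , distinct) =
    reverseʷ p , geodesic-reverseʷ p geodesic ,
    subst Unique (sym (colours-reverseʷ colouring p)) (unique-reverse distinct)

  rainbow : IsStrongRainbow colouring
  rainbow (x , a) (y , b) _ with offset x y + offset x y ≤? n
  ... | yes short = subst (λ z → RainbowGeodesic (x , a) (z , b)) (shift-offset x y)
                          (rainbow-short x a b (offset x y) short)
  ... | no  long  = reverse-rainbow (subst (λ z → RainbowGeodesic (y , b) (z , a)) (shift-offset y x)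
                          (rainbow-short y b a (offset y x) (other-arc-short x≢y long)))
    where
    x≢y : x ≢ y
    x≢y refl = long (subst Short (sym (offset-self x)) z≤n)

module Colourings (n m : ℕ) .{{_ : NonZero n}} .{{_ : NonZero m}} where
  open CycleArithmetic n

  residue-spread : ∀ {x y} → m + m ≤ n → toℕ x < m + m →
                   toℕ x % m ≡ toℕ y % m → x ≡ y ⊎ m ≤ offset x y
  residue-spread {x} {y} 2m≤n x<2m same with offset-spec x y
  ... | inj₂ wraps = inj₂ (+-cancelˡ-≤ (toℕ x) m (offset x y) (begin
    toℕ x + m            ≤⟨ residue-gap m (trans same (sym (+-double-residue (toℕ y) m)))
                                          (<-≤-trans x<2m (m≤n+m (m + m) (toℕ y))) ⟩
    toℕ y + (m + m)      ≤⟨ +-monoʳ-≤ (toℕ y) 2m≤n ⟩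
    toℕ y + n            ≡⟨ sym wraps ⟩
    toℕ x + offset x y   ∎))
    where open ≤-Reasoning
  ... | inj₁ reaches with toℕ x <? toℕ y
  ...   | yes x<y = inj₂ (+-cancelˡ-≤ (toℕ x) m (offset x y)
                           (subst (toℕ x + m ≤_) (sym reaches) (residue-gap m same x<y)))
  ...   | no  x≮y = inj₁ (toℕ-injective (≤-antisym (subst (toℕ x ≤_) reaches (m≤m+n (toℕ x) (offset x y)))
                                                    (≮⇒≥ x≮y)))

  evenColouring : n ≡ m + m → SpreadColouring n m (suc m)
  evenColouring n≡2m = record
    { edge        = λ x → toℕ x % m
    ; rung        = λ _ → m
    ; edge<K      = λ x → m<n⇒m<1+n (m%n<n (toℕ x) m)
    ; rung<K      = λ _ → n<1+n m
    ; edge-spread = λ x y → residue-spread (≤-reflexive (sym n≡2m)) (subst (toℕ x <_) n≡2m (toℕ<n x))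
    ; rung-spread = λ x y same → ⊥-elim (<-irrefl same (m%n<n (toℕ x) m))
    }

  oddEdge : ℕ → ℕ
  oddEdge t with t <? m + m
  ... | yes _ = t % m
  ... | no  _ = m

  oddRung : ℕ → ℕ
  oddRung t with t <? m
  ... | yes _ = t
  ... | no  _ = m

  oddEdge<1+m : ∀ t → oddEdge t < suc m
  oddEdge<1+m t with t <? m + m
  ... | yes _ = m<n⇒m<1+n (m%n<n t m)
  ... | no  _ = n<1+n m

  oddRung<1+m : ∀ t → oddRung t < suc m
  oddRung<1+m t with t <? m
  ... | yes t<m = m<n⇒m<1+n t<m
  ... | no  _   = n<1+n m

  module Odd (n≡2m+1 : n ≡ suc (m + m)) where
    2m≤n : m + m ≤ n
    2m≤n = ≤-trans (n≤1+n (m + m)) (≤-reflexive (sym n≡2m+1))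

    last-vertex : ∀ x → toℕ x ≮ m + m → toℕ x ≡ m + m
    last-vertex x x≮2m = ≤-antisym (≤-pred (subst (toℕ x <_) n≡2m+1 (toℕ<n x))) (≮⇒≥ x≮2m)

    edge-spread : ∀ x y → oddEdge (toℕ x) ≡ oddEdge (toℕ y) → x ≡ y ⊎ m ≤ offset x y
    edge-spread x y same with toℕ x <? m + m | toℕ y <? m + m
    ... | yes x<2m | yes _ = residue-spread 2m≤n x<2m same
    ... | yes _    | no  _ = ⊥-elim (<-irrefl same (m%n<n (toℕ x) m))
    ... | no  _    | yes _ = ⊥-elim (<-irrefl (sym same) (m%n<n (toℕ y) m))
    ... | no  x≮2m | no y≮2m = inj₁ (toℕ-injective (trans (last-vertex x x≮2m) (sym (last-vertex y y≮2m))))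

    -- A rung at y < m is coloured y; the edges of that colour leave y and y + m,
    -- and y + m lies m + 1 steps before y.
    rung-spread-low : ∀ {x y} → toℕ x < m + m → toℕ y < m → toℕ x % m ≡ toℕ y →
                      x ≡ y ⊎ m < offset x y
    rung-spread-low {x} {y} x<2m y<m same with offset-spec x y
    ... | inj₁ reaches = inj₁ (toℕ-injective (trans (sym (m<n⇒m%n≡m x<m)) same))
      where
      x<m : toℕ x < m
      x<m = ≤-<-trans (subst (toℕ x ≤_) reaches (m≤m+n (toℕ x) (offset x y))) y<m
    ... | inj₂ wraps = inj₂ (+-cancelˡ-≤ (toℕ x) (suc m) (offset x y) (begin
      toℕ x + suc m        ≤⟨ +-monoˡ-≤ (suc m) x≤y+m ⟩
      toℕ y + m + suc m    ≡⟨ +-assoc (toℕ y) m (suc m) ⟩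
      toℕ y + (m + suc m)  ≡⟨ cong (toℕ y +_) (trans (+-suc m m) (sym n≡2m+1)) ⟩
      toℕ y + n            ≡⟨ sym wraps ⟩
      toℕ x + offset x y   ∎))
      where
      open ≤-Reasoning
      -- x is y or y + m, since it has residue y and lies below 2m.
      x≤y+m : toℕ x ≤ toℕ y + m
      x≤y+m = ≮⇒≥ λ y+m<x → <⇒≱ x<2m (begin
        m + m              ≤⟨ +-monoˡ-≤ m (m≤n+m m (toℕ y)) ⟩
        toℕ y + m + m      ≤⟨ residue-gap m (trans ([m+n]%n≡m%n (toℕ y) m)
                                            (trans (m<n⇒m%n≡m y<m) (sym same))) y+m<x ⟩
        toℕ x              ∎)

    -- The rungs at y ≥ m share colour m with the last edge, which leaves 2m
    -- and so lies y + 1 > m steps before y.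
    rung-spread-high : ∀ {x y} → toℕ x ≡ m + m → m ≤ toℕ y → x ≡ y ⊎ m < offset x y
    rung-spread-high {x} {y} x≡2m m≤y with offset-spec x y
    ... | inj₁ reaches = inj₁ (toℕ-injective (≤-antisym x≤y y≤x))
      where
      x≤y : toℕ x ≤ toℕ y
      x≤y = subst (toℕ x ≤_) reaches (m≤m+n (toℕ x) (offset x y))
      y≤x : toℕ y ≤ toℕ x
      y≤x = ≤-pred (subst (toℕ y <_) (trans n≡2m+1 (cong suc (sym x≡2m))) (toℕ<n y))
    ... | inj₂ wraps = inj₂ (subst (m <_) (sym offset≡y+1) (s≤s m≤y))
      where
      open ≡-Reasoning
      offset≡y+1 : offset x y ≡ suc (toℕ y)
      offset≡y+1 = +-cancelˡ-≡ (m + m) (offset x y) (suc (toℕ y)) (begin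
        m + m + offset x y     ≡⟨ cong (_+ offset x y) (sym x≡2m) ⟩
        toℕ x + offset x y     ≡⟨ wraps ⟩
        toℕ y + n              ≡⟨ cong (toℕ y +_) n≡2m+1 ⟩
        toℕ y + suc (m + m)    ≡⟨ +-comm (toℕ y) (suc (m + m)) ⟩
        suc (m + m + toℕ y)    ≡⟨ sym (+-suc (m + m) (toℕ y)) ⟩
        m + m + suc (toℕ y)    ∎)

    rung-spread : ∀ x y → oddEdge (toℕ x) ≡ oddRung (toℕ y) → x ≡ y ⊎ m < offset x y
    rung-spread x y same with toℕ x <? m + m | toℕ y <? m
    ... | yes x<2m | yes y<m = rung-spread-low x<2m y<m same
    ... | yes _    | no  _   = ⊥-elim (<-irrefl same (m%n<n (toℕ x) m))
    ... | no  _    | yes y<m = ⊥-elim (<-irrefl (sym same) y<m)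
    ... | no  x≮2m | no  y≮m = rung-spread-high (last-vertex x x≮2m) (≮⇒≥ y≮m)

  oddColouring : n ≡ suc (m + m) → SpreadColouring n m (suc m)
  oddColouring n≡2m+1 = record
    { edge        = λ x → oddEdge (toℕ x)
    ; rung        = λ x → oddRung (toℕ x)
    ; edge<K      = λ x → oddEdge<1+m (toℕ x)
    ; rung<K      = λ x → oddRung<1+m (toℕ x)
    ; edge-spread = Odd.edge-spread n≡2m+1
    ; rung-spread = Odd.rung-spread n≡2m+1
    }

lemma2p3 : ∀ (n : ℕ) → 3 ≤ n → SrcIs (Cycle n □ C₂) ⌈ suc n /2⌉
lemma2p3 n 2<n@(s≤s (s≤s (s≤s _))) = (colouring , rainbow) , Prism.src-lower n zero
  where
  m : ℕ
  m = ⌊ n /2⌋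

  spread : SpreadColouring n m (suc m)
  spread with halving n
  ... | inj₁ even = Colourings.evenColouring n m even
  ... | inj₂ odd  = Colourings.oddColouring n m odd

  n≤2m+1 : n ≤ suc (m + m)
  n≤2m+1 with halving n
  ... | inj₁ even = ≤-trans (≤-reflexive even) (n≤1+n (m + m))
  ... | inj₂ odd  = ≤-reflexive odd

  open FromSpread 2<n n≤2m+1 spread
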